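{- In $\mathcal{U}_h(\mathfrak{sl}_{n+1})$, let $1\le i<j\le n$ and $s\in\{i,\dots,j-1\}$. Then $$\mathsf{x}_{i,j}=q^{\frac12}\,\mathsf{x}_{i,s}\mathsf{x}_{s+1,j}-q^{ -\frac12}\,\mathsf{x}_{s+1,j}\mathsf{x}_{i,s}.$$
   Context: $\mathcal{U}_h(\mathfrak{sl}_{n+1})$ ($n\ge1$) is the $h$-adically complete $\mathbb{C}[[h]]$-algebra topologically generated by $\mathsf{x}_i,\mathsf{y}_i,\mathsf{H}_i$ ($1\le i\le n$) subject to: $[\mathsf{H}_i,\mathsf{H}_j]=0$; $[\mathsf{H}_i,\mathsf{x}_j]=2\mathsf{x}_j$ if $j=i$, $-\mathsf{x}_j$ if $|i-j|=1$, $0$ otherwise; $[\mathsf{H}_i,\mathsf{y}_j]=-2\mathsf{y}_j$ if $j=i$, $\mathsf{y}_j$ if $|i-j|=1$, $0$ otherwise; $[\mathsf{x}_i,\mathsf{y}_j]=\delta_{ij}\frac{\mathsf{k}_i^2-\mathsf{k}_i^{ -2}}{q-q^{ -1}}$ with $\mathsf{k}_i=e^{h\mathsf{H}_i/4}$, $q=e^{h/2}$; $\mathsf{x}_i\mathsf{x}_j=\mathsf{x}_j\mathsf{x}_i$ and $\mathsf{y}_i\mathsf{y}_j=\mathsf{y}_j\mathsf{y}_i$ for $|i-j|>1$; and for $|i-j|=1$ the $q$-Serre relations $\mathsf{x}_i^2\mathsf{x}_j-(q+q^{ -1})\mathsf{x}_i\mathsf{x}_j\mathsf{x}_i+\mathsf{x}_j\mathsf{x}_i^2=0$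 and the same with $\mathsf{y}$ in place of $\mathsf{x}$. Set $\mathsf{x}_{i,i}=\mathsf{x}_i$ and, for $1\le i<j\le n$, inductively $\mathsf{x}_{i,j}=q^{\frac12}\mathsf{x}_i\mathsf{x}_{i+1,j}-q^{ -\frac12}\mathsf{x}_{i+1,j}\mathsf{x}_i$. -}

module Defs where

open import Level using (_⊔_)
open import Algebra.Bundles using (Ring)
open import Data.Nat using (ℕ; zero; suc; _≤_; _<_; _∸_)
open import Data.Sum using (_⊎_)
open import Relation.Binary.PropositionalEquality using (_≡_)

-- Everything is relative to an arbitrary (possibly noncommutative) ring A,
-- playing the role of U_h(sl_{n+1}); t plays the role of q^{1/2}.
module _ {c ℓ} (A : Ring c ℓ) where
  open Ring A

  _⊖_ : Carrier → Carrier → Carrier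
  a ⊖ b = a + (- b)

  qbr : (t t⁻¹ : Carrier) → Carrier → Carrier → Carrier
  qbr t t⁻¹ a b = (t * (a * b)) ⊖ (t⁻¹ * (b * a))

  -- xLen t t⁻¹ x i k = x_{i,i+k}, by the paper's inductive definition
  -- x_{i,i} = x_i,  x_{i,j} = q^{1/2} x_i x_{i+1,j} - q^{-1/2} x_{i+1,j} x_i.
  xLen : (t t⁻¹ : Carrier) → (ℕ → Carrier) → ℕ → ℕ → Carrier
  xLen t t⁻¹ x i zero    = x i
  xLen t t⁻¹ x i (suc k) = qbr t t⁻¹ (x i) (xLen t t⁻¹ x (suc i) k)

  -- x_{i,j} (meaningful for i ≤ j)
  xij : (t t⁻¹ : Carrier) → (ℕ → Carrier) → ℕ → ℕ → Carrier
  xij t t⁻¹ x i j = xLen t t⁻¹ x i (j ∸ i)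

  -- The defining relations of U_h(sl_{n+1}) involving only the generators x_i
  -- (1 ≤ i ≤ n), with t = q^{1/2} a central invertible element, q = t².
  record XRelations (n : ℕ) (t t⁻¹ : Carrier) (x : ℕ → Carrier) : Set (c ⊔ ℓ) where
    field
      t-invˡ   : t⁻¹ * t ≈ 1#
      t-invʳ   : t * t⁻¹ ≈ 1#
      t-central : ∀ a → t * a ≈ a * t
      x-comm   : ∀ i j → 1 ≤ i → i ≤ n → 1 ≤ j → j ≤ n →
                 (suc i < j ⊎ suc j < i) → x i * x j ≈ x j * x i
      x-serre  : ∀ i j → 1 ≤ i → i ≤ n → 1 ≤ j → j ≤ n →
                 (suc i ≡ j ⊎ suc j ≡ i) →
                 ((x i * (x i * x j)) ⊖ (((t * t) + (t⁻¹ * t⁻¹)) * (x i * (x j * x i))))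
                   + (x j * (x i * x i)) ≈ 0#

module Submission where

-- Write [a,b] = t a b - t⁻¹ b a for the t-commutator (t = q^{1/2} central and
-- invertible).  The only algebraic input is a t-Jacobi identity:
--
--     if a commutes with d, then  [[a,b],d] = [a,[b,d]],
--
-- since both sides expand to  t² abd - bad - dab + t⁻² dba  resp.
-- t² abd - adb - bda + t⁻² dba,  which agree once ad = da.  Next, x_i commutes
-- with every x_m for m ≥ i+2, hence with every root vector x_{k,l} with k ≥ i+2,
-- because commuting with a fixed element is preserved by t-commutators.
-- Finally, x_{i,j} = [x_i, x_{i+1,j}]; splitting x_{i+1,j} at s by induction and
-- reassociating with the t-Jacobi identity gives
--     [x_i,[x_{i+1,s}, x_{s+1,j}]] = [[x_i, x_{i+1,s}], x_{s+1,j}] = [x_{i,s}, x_{s+1,j}].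

open import Defs
open import Level using (_⊔_)
open import Algebra.Bundles using (Ring)
open import Data.Nat using (ℕ; zero; suc; _∸_; _≤_; _<_; s≤s; z≤n) renaming (_+_ to _+ⁿ_)
open import Data.Nat.Properties
  using (≤-refl; ≤-reflexive; ≤-trans; n≤1+n; m≤m+n; m≤n+m; +-suc; +-∸-comm;
         m+n∸n≡m; m+n∸m≡n; m∸n+n≡m; m+[n∸m]≡n)
open import Data.Sum using (inj₁)
open import Relation.Binary.PropositionalEquality as P using (_≡_)
import Algebra.Properties.Ring as RingProperties
import Relation.Binary.Reasoning.Setoid as SetoidReasoning

module TCommutator {c ℓ} (A : Ring c ℓ) where
  open Ring A
  open RingProperties A
    using (x[y-z]≈xy-xz; [y-z]x≈yx-zx; ⁻¹-anti-homo‿-; -‿distribˡ-*; -‿distribʳ-*)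
  open SetoidReasoning setoid

  Commute : Carrier → Carrier → Set ℓ
  Commute a b = a * b ≈ b * a

  Central : Carrier → Set (c ⊔ ℓ)
  Central z = ∀ a → Commute z a

  commute-* : ∀ {a b d} → Commute a b → Commute a d → Commute a (b * d)
  commute-* {a} {b} {d} ab ad = begin
    a * (b * d) ≈⟨ *-assoc a b d ⟨
    (a * b) * d ≈⟨ *-congʳ ab ⟩
    (b * a) * d ≈⟨ *-assoc b a d ⟩
    b * (a * d) ≈⟨ *-congˡ ad ⟩
    b * (d * a) ≈⟨ *-assoc b d a ⟨
    (b * d) * a ∎

  commute-+ : ∀ {a b d} → Commute a b → Commute a d → Commute a (b + d)
  commute-+ {a} {b} {d} ab ad = begin
    a * (b + d)   ≈⟨ distribˡ a b d ⟩
    a * b + a * d ≈⟨ +-cong ab ad ⟩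
    b * a + d * a ≈⟨ distribʳ a b d ⟨
    (b + d) * a   ∎

  commute-neg : ∀ {a b} → Commute a b → Commute a (- b)
  commute-neg {a} {b} ab = begin
    a * - b   ≈⟨ -‿distribʳ-* a b ⟨
    - (a * b) ≈⟨ -‿cong ab ⟩
    - (b * a) ≈⟨ -‿distribˡ-* b a ⟩
    - b * a   ∎

  cancel : ∀ {a b} → a * b ≈ 1# → ∀ z → a * (b * z) ≈ z
  cancel {a} {b} ab z = trans (sym (*-assoc a b z)) (trans (*-congʳ ab) (*-identityˡ z))

  central-inverse : ∀ {t u} → Central t → t * u ≈ 1# → u * t ≈ 1# → Central u
  central-inverse {t} {u} tc tu ut a = begin
    u * a             ≈⟨ *-identityʳ (u * a) ⟨
    (u * a) * 1#      ≈⟨ *-congˡ tu ⟨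
    (u * a) * (t * u) ≈⟨ *-assoc u a (t * u) ⟩
    u * (a * (t * u)) ≈⟨ *-congˡ (*-assoc a t u) ⟨
    u * ((a * t) * u) ≈⟨ *-congˡ (*-congʳ (tc a)) ⟨
    u * ((t * a) * u) ≈⟨ *-congˡ (*-assoc t a u) ⟩
    u * (t * (a * u)) ≈⟨ cancel ut (a * u) ⟩
    a * u             ∎

  central-slide : ∀ {z} → Central z → ∀ d X → d * (z * X) ≈ z * (d * X)
  central-slide {z} zc d X = begin
    d * (z * X) ≈⟨ *-assoc d z X ⟨
    (d * z) * X ≈⟨ *-congʳ (zc d) ⟨
    (z * d) * X ≈⟨ *-assoc z d X ⟩
    z * (d * X) ∎

  sub-cong : ∀ {a b a′ b′} → a ≈ a′ → b ≈ b′ → a - b ≈ a′ - b′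
  sub-cong p q = +-cong p (-‿cong q)

  sub-sub-exchange : ∀ P B C Q → (P - B) - (C - Q) ≈ (P - C) - (B - Q)
  sub-sub-exchange P B C Q = begin
    (P - B) - (C - Q)   ≈⟨ +-congˡ (⁻¹-anti-homo‿- C Q) ⟩
    (P - B) + (Q - C)   ≈⟨ +-assoc P (- B) (Q - C) ⟩
    P + (- B + (Q - C)) ≈⟨ +-congˡ (+-assoc (- B) Q (- C)) ⟨
    P + ((- B + Q) - C) ≈⟨ +-congˡ (+-comm (- B + Q) (- C)) ⟩
    P + (- C + (- B + Q)) ≈⟨ +-assoc P (- C) (- B + Q) ⟨
    (P - C) + (- B + Q) ≈⟨ +-congˡ (+-comm (- B) Q) ⟩
    (P - C) + (Q - B)   ≈⟨ +-congˡ (⁻¹-anti-homo‿- B Q) ⟨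
    (P - C) - (B - Q)   ∎

  module WithCentralUnit (t u : Carrier) (tu : t * u ≈ 1#) (ut : u * t ≈ 1#) (tc : Central t) where

    uc : Central u
    uc = central-inverse tc tu ut

    tdiff : Carrier → Carrier → Carrier
    tdiff X Y = t * X - u * Y

    tdiff-cong : ∀ {X Y X′ Y′} → X ≈ X′ → Y ≈ Y′ → tdiff X Y ≈ tdiff X′ Y′
    tdiff-cong p q = sub-cong (*-congˡ p) (*-congˡ q)

    qbr-congʳ : ∀ a {b b′} → b ≈ b′ → qbr A t u a b ≈ qbr A t u a b′
    qbr-congʳ a p = tdiff-cong (*-congˡ p) (*-congʳ p)

    commute-qbr : ∀ {a b d} → Commute a b → Commute a d → Commute a (qbr A t u b d)
    commute-qbr {a} ab ad =
      commute-+ (commute-* (sym (tc a)) (commute-* ab ad))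
                (commute-neg (commute-* (sym (uc a)) (commute-* ad ab)))

    tdiff-*ʳ : ∀ X Y d → tdiff X Y * d ≈ tdiff (X * d) (Y * d)
    tdiff-*ʳ X Y d = trans ([y-z]x≈yx-zx d (t * X) (u * Y))
                           (sub-cong (*-assoc t X d) (*-assoc u Y d))

    tdiff-*ˡ : ∀ X Y d → d * tdiff X Y ≈ tdiff (d * X) (d * Y)
    tdiff-*ˡ X Y d = trans (x[y-z]≈xy-xz d (t * X) (u * Y))
                           (sub-cong (central-slide tc d X) (central-slide uc d Y))

    tdiff-tdiff : ∀ X Y Z W →
      tdiff (tdiff X Y) (tdiff Z W) ≈ (t * (t * X) - Y) - (Z - u * (u * W))
    tdiff-tdiff X Y Z W = begin
      t * (t * X - u * Y) - u * (t * Z - u * W)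
        ≈⟨ sub-cong (x[y-z]≈xy-xz t (t * X) (u * Y)) (x[y-z]≈xy-xz u (t * Z) (u * W)) ⟩
      (t * (t * X) - t * (u * Y)) - (u * (t * Z) - u * (u * W))
        ≈⟨ sub-cong (sub-cong refl (cancel tu Y)) (sub-cong (cancel ut Z) refl) ⟩
      (t * (t * X) - Y) - (Z - u * (u * W)) ∎

    t-jacobi : ∀ a b d → Commute a d →
      qbr A t u (qbr A t u a b) d ≈ qbr A t u a (qbr A t u b d)
    t-jacobi a b d ad = begin
      tdiff (tdiff (a * b) (b * a) * d) (d * tdiff (a * b) (b * a))
        ≈⟨ tdiff-cong (tdiff-*ʳ (a * b) (b * a) d) (tdiff-*ˡ (a * b) (b * a) d) ⟩
      tdiff (tdiff ((a * b) * d) ((b * a) * d)) (tdiff (d * (a * b)) (d * (b * a)))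
        ≈⟨ tdiff-tdiff _ _ _ _ ⟩
      (t * (t * ((a * b) * d)) - (b * a) * d) - (d * (a * b) - u * (u * (d * (b * a))))
        ≈⟨ sub-cong (sub-cong (*-congˡ (*-congˡ (*-assoc a b d))) bad≈bda)
                    (sub-cong dab≈adb (*-congˡ (*-congˡ (sym (*-assoc d b a))))) ⟩
      (t * (t * (a * (b * d))) - (b * d) * a) - (a * (d * b) - u * (u * ((d * b) * a)))
        ≈⟨ sub-sub-exchange _ _ _ _ ⟩
      (t * (t * (a * (b * d))) - a * (d * b)) - ((b * d) * a - u * (u * ((d * b) * a)))
        ≈⟨ tdiff-tdiff _ _ _ _ ⟨
      tdiff (tdiff (a * (b * d)) (a * (d * b))) (tdiff ((b * d) * a) ((d * b) * a))
        ≈⟨ tdiff-cong (tdiff-*ˡ (b * d) (d * b) a) (tdiff-*ʳ (b * d) (d * b) a) ⟨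
      tdiff (a * tdiff (b * d) (d * b)) (tdiff (b * d) (d * b) * a) ∎
      where
      bad≈bda : (b * a) * d ≈ (b * d) * a
      bad≈bda = trans (*-assoc b a d) (trans (*-congˡ ad) (sym (*-assoc b d a)))
      dab≈adb : d * (a * b) ≈ a * (d * b)
      dab≈adb = trans (sym (*-assoc d a b)) (trans (*-congʳ (sym ad)) (*-assoc a d b))

module RootVectors {c ℓ} (A : Ring c ℓ) (n : ℕ) (t u : Ring.Carrier A)
  (x : ℕ → Ring.Carrier A) (R : XRelations A n t u x) where
  open Ring A
  open XRelations R
  open TCommutator A
  open WithCentralUnit t u t-invʳ t-invˡ t-central

  x-far-commute : ∀ i m → 1 ≤ i → suc (suc i) ≤ m → m ≤ n → Commute (x i) (x m)
  x-far-commute i m 1≤i i+2≤m m≤n =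
    x-comm i m 1≤i i≤n (≤-trans (s≤s z≤n) i+2≤m) m≤n (inj₁ i+2≤m)
    where
    i≤n : i ≤ n
    i≤n = ≤-trans (n≤1+n i) (≤-trans (n≤1+n (suc i)) (≤-trans i+2≤m m≤n))

  commute-xLen : ∀ a len k → (∀ m → k ≤ m → m ≤ k +ⁿ len → Commute a (x m)) →
                 Commute a (xLen A t u x k len)
  commute-xLen a zero    k h = h k ≤-refl (m≤m+n k 0)
  commute-xLen a (suc len) k h =
    commute-qbr (h k ≤-refl (m≤m+n k (suc len)))
                (commute-xLen a len (suc k) λ m k<m m≤k+len →
                   h m (≤-trans (n≤1+n k) k<m) (≤-trans m≤k+len (≤-reflexive (P.sym (+-suc k len)))))

  xLen-split : ∀ a i b → 1 ≤ i → suc (a +ⁿ i +ⁿ b) ≤ n →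
    xLen A t u x i (suc (a +ⁿ b)) ≈ qbr A t u (xLen A t u x i a) (xLen A t u x (suc (a +ⁿ i)) b)
  xLen-split zero    i b 1≤i bound = refl
  xLen-split (suc a) i b 1≤i bound = begin
    qbr A t u (x i) (xLen A t u x (suc i) (suc (a +ⁿ b)))
      ≈⟨ qbr-congʳ (x i) inner-split ⟩
    qbr A t u (x i) (qbr A t u (xLen A t u x (suc i) a) (xLen A t u x (suc (suc (a +ⁿ i))) b))
      ≈⟨ t-jacobi (x i) (xLen A t u x (suc i) a) (xLen A t u x (suc (suc (a +ⁿ i))) b) far ⟨
    qbr A t u (xLen A t u x i (suc a)) (xLen A t u x (suc (suc (a +ⁿ i))) b) ∎
    where
    open SetoidReasoning setoid
    -- the induction hypothesis at i + 1, with a + (i + 1) = (a + i) + 1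
    inner-split : xLen A t u x (suc i) (suc (a +ⁿ b)) ≈
                  qbr A t u (xLen A t u x (suc i) a) (xLen A t u x (suc (suc (a +ⁿ i))) b)
    inner-split = P.subst
      (λ k → xLen A t u x (suc i) (suc (a +ⁿ b)) ≈
               qbr A t u (xLen A t u x (suc i) a) (xLen A t u x (suc k) b))
      (+-suc a i)
      (xLen-split a (suc i) b (s≤s z≤n) (P.subst (λ k → suc (k +ⁿ b) ≤ n) (P.sym (+-suc a i)) bound))
    far : Commute (x i) (xLen A t u x (suc (suc (a +ⁿ i))) b)
    far = commute-xLen (x i) b (suc (suc (a +ⁿ i))) λ m k≤m m≤k+b →
      x-far-commute i m 1≤i (≤-trans (s≤s (s≤s (m≤n+m i a))) k≤m) (≤-trans m≤k+b bound)

  xij-split : ∀ {i s j} (a b : ℕ) → a +ⁿ i ≡ s → suc s +ⁿ b ≡ j → 1 ≤ i → j ≤ n →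
    xij A t u x i j ≈ qbr A t u (xij A t u x i s) (xij A t u x (suc s) j)
  xij-split {i} a b P.refl P.refl 1≤i bound = begin
    xLen A t u x i (suc (a +ⁿ i +ⁿ b) ∸ i)
      ≡⟨ P.cong (xLen A t u x i) total-length ⟩
    xLen A t u x i (suc (a +ⁿ b))
      ≈⟨ xLen-split a i b 1≤i bound ⟩
    qbr A t u (xLen A t u x i a) (xLen A t u x (suc (a +ⁿ i)) b)
      ≡⟨ P.cong₂ (λ k l → qbr A t u (xLen A t u x i k) (xLen A t u x (suc (a +ⁿ i)) l))
                 (P.sym (m+n∸n≡m a i)) (P.sym (m+n∸m≡n (suc (a +ⁿ i)) b)) ⟩
    qbr A t u (xLen A t u x i (a +ⁿ i ∸ i)) (xLen A t u x (suc (a +ⁿ i)) (suc (a +ⁿ i) +ⁿ b ∸ suc (a +ⁿ i))) ∎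
    where
    open SetoidReasoning setoid
    total-length : suc (a +ⁿ i +ⁿ b) ∸ i ≡ suc (a +ⁿ b)
    total-length = P.trans (+-∸-comm b (m≤n+m i (suc a))) (P.cong (_+ⁿ b) (m+n∸n≡m (suc a) i))

lemma5p3 : ∀ {c ℓ} (A : Ring c ℓ) (n : ℕ) (t t⁻¹ : Ring.Carrier A) (x : ℕ → Ring.Carrier A) →
    XRelations A n t t⁻¹ x →
    ∀ (i j s : ℕ) → 1 ≤ i → i ≤ s → s < j → j ≤ n →
    Ring._≈_ A (xij A t t⁻¹ x i j)
      (qbr A t t⁻¹ (xij A t t⁻¹ x i s) (xij A t t⁻¹ x (suc s) j))
lemma5p3 A n t t⁻¹ x R i j s 1≤i i≤s s<j j≤n =
  RootVectors.xij-split A n t t⁻¹ x R (s ∸ i) (j ∸ suc s)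
    (m∸n+n≡m i≤s) (m+[n∸m]≡n s<j) 1≤i j≤n
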